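{- Let $n\ge0$. The map $\phi$ sending a perfect matching $P$ of the ladder graph $H_{2n+1}$ to the pair $(S_1,S_2)$, where $u_i\in S_1\iff A_{2i}A_{2i+1},B_{2i}B_{2i+1}\in P$ for $0\le i\le n$, and $v_i\in S_2\iff A_{2i-1}A_{2i},B_{2i-1}B_{2i}\in P$ for $1\le i\le n$, is a well-defined bijection from the set of perfect matchings of $H_{2n+1}$ (the snake graph $G_{T,\gamma_{n+3}}$) onto the set of compatible pairs on the maximal Dyck path $\mathcal{D}^{(n+1)\times n}$.
   Context: For $m\ge1$, $H_m$ is the ladder graph with vertices $A_0,\dots,A_m,B_0,\dots,B_m$ and edges $A_iB_i$ ($0\le i\le m$), $A_iA_{i+1}$, $B_iB_{i+1}$ ($0\le i\le m-1$); for the annulus with one marked point on each boundary circle and triangulation $T=\{\tau_1,\tau_2\}$, the snake graph $G_{T,\gamma_{n+3}}$ is $H_{2n+1}$. A perfect matching is a set of edges covering each vertex exactly once. $\mathcal{D}=\mathcal{D}^{(n+1)\times n}$ is the lattice path from $(0,0)$ to $(n+1,n)$ with vertices $A_0=(0,0)$, $A_1=B_0=(1,0)$, and for $1\le i\le n$, $B_i=(i+1,i-1)$, $A_{i+1}=(i+1,i)$ (the highest unit up/right lattice path not going strictly above the segment from $(0,0)$ to $(n+1,n)$). Horizontal edges: $u_i=A_iB_i$ ($0\le i\le n$), $\mathcal{D}_1=\{u_0,\dots,u_n\}$; vertical edges: $v_j=B_jA_{j+1}$ ($1\le j\le n$), $\mathcal{D}_2=\{v_1,\dots,v_n\}$.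 Identify $(n+1,n)$ with $(0,0)$. For lattice points $P,Q$ on $\mathcal{D}$, the subpath $PQ$ is the part of $\mathcal{D}$ from $P$ going northeast until $Q$, looping from $(n+1,n)$ to $(0,0)$ if needed (if $P=Q$, the full loop from $P$ back to $P$); $(PQ)_1,(PQ)_2$ are its horizontal/vertical edges and $(PQ)^\circ$ its lattice points other than $P,Q$. A pair $(S_1,S_2)$, $S_1\subseteq\mathcal{D}_1$, $S_2\subseteq\mathcal{D}_2$, is compatible if for all $u\in S_1$, $v\in S_2$, with $E$ the left endpoint of $u$ and $F$ the upper endpoint of $v$, there exists $A\in(EF)^\circ$ such that $|(AF)_1|=2|(AF)_2\cap S_2|$ or $|(EA)_2|=2|(EA)_1\cap S_1|$. -}

module Defs where

open import Data.Bool using (Bool; true; false; _∧_; if_then_else_)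
open import Data.Nat using (ℕ; zero; suc; _+_; _*_; _∸_; _<_; _≡ᵇ_; s≤s)
open import Data.Nat.Properties using (*-monoʳ-≤; *-monoʳ-<)
open import Data.Nat.DivMod using (_%_)
open import Data.Fin using (Fin; toℕ; fromℕ<; inject₁) renaming (suc to fsuc; zero to fzero)
open import Data.Fin.Properties using (toℕ≤pred[n]; toℕ<n)
open import Data.Fin.Subset using (Subset)
open import Data.Vec using (Vec; []; _∷_; tabulate)
open import Data.Product using (_×_; _,_; proj₁; proj₂; ∃-syntax)
open import Data.Sum using (_⊎_)
open import Relation.Binary.PropositionalEquality using (_≡_)

data Vertex (m : ℕ) : Set where
  A : Fin (suc m) → Vertex m
  B : Fin (suc m) → Vertex m

data LEdge (m : ℕ) : Set where
  rung : Fin (suc m) → LEdge m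
  top  : Fin m → LEdge m
  bot  : Fin m → LEdge m

ends : ∀ {m} → LEdge m → Vertex m × Vertex m
ends (rung i) = A i , B i
ends (top i)  = A (inject₁ i) , A (fsuc i)
ends (bot i)  = B (inject₁ i) , B (fsuc i)

Incident : ∀ {m} → LEdge m → Vertex m → Set
Incident e v = proj₁ (ends e) ≡ v ⊎ proj₂ (ends e) ≡ v

EdgeSet : ℕ → Set
EdgeSet m = LEdge m → Bool

IsPerfectMatching : ∀ {m} → EdgeSet m → Set
IsPerfectMatching {m} P =
  ∀ (v : Vertex m) → ∃[ e ] (Incident e v × P e ≡ true ×
     (∀ e' → Incident e' v → P e' ≡ true → e' ≡ e))

-- index 2i of a top/bottom edge, for 0 ≤ i ≤ n
evenIx : ∀ {n} → Fin (suc n) → Fin (suc (2 * n))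
evenIx {n} i = fromℕ< (s≤s (*-monoʳ-≤ 2 (toℕ≤pred[n] i)))

-- index 2j+1 for 0 ≤ j ≤ n-1 (i.e. 2i-1 with i = j+1 ∈ {1..n})
oddIx : ∀ {n} → Fin n → Fin (suc (2 * n))
oddIx {n} j = fromℕ< (s≤s (*-monoʳ-< 2 (toℕ<n j)))

-- φ P = (S₁ , S₂):  S₁ ⊆ {u_0..u_n} stored as Subset (n+1) (index i ↦ u_i),
--                   S₂ ⊆ {v_1..v_n} stored as Subset n (index j ↦ v_{j+1}).
φ : ∀ n → EdgeSet (suc (2 * n)) → Subset (suc n) × Subset n
φ n P = tabulate (λ i → P (top (evenIx i)) ∧ P (bot (evenIx i)))
      , tabulate (λ j → P (top (oddIx j)) ∧ P (bot (oddIx j)))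

-- The maximal Dyck path D^{(n+1)×n}
-- The closed path has L = 2n+1 lattice points (after identifying
-- (n+1,n) with (0,0)); we number them 0..2n in path order:
--   point 0 = A_0 = (0,0), point 1 = A_1 = B_0 = (1,0),
--   point 2i-1 = A_i = (i,i-1), point 2i = B_i = (i+1,i-1)  (1 ≤ i ≤ n).
-- Edge at position p goes from point p to point p+1 (mod L):
--   position 0 = u_0, position 2i-1 = u_i, position 2j = v_j.

L : ℕ → ℕ
L n = suc (2 * n)

-- edge labels: hor i = u_i (0 ≤ i ≤ n), ver j = v_{j+1} (0 ≤ j ≤ n-1)
data DEdge : Set where
  hor : ℕ → DEdge
  ver : ℕ → DEdge

bump : DEdge → DEdge
bump (hor i) = hor (suc i)
bump (ver j) = ver (suc j)

edgeFrom1 : ℕ → DEdge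
edgeFrom1 zero = hor 1
edgeFrom1 (suc zero) = ver 0
edgeFrom1 (suc (suc k)) = bump (edgeFrom1 k)

edgeAt : ℕ → DEdge
edgeAt zero = hor 0
edgeAt (suc k) = edgeFrom1 k

-- membership in a subset via a natural-number index (false out of range)
lookupℕ : ∀ {k} → Vec Bool k → ℕ → Bool
lookupℕ [] _ = false
lookupℕ (b ∷ _) zero = b
lookupℕ (_ ∷ v) (suc i) = lookupℕ v i

count : ℕ → (ℕ → Bool) → ℕ
count zero f = 0
count (suc ℓ) f = count ℓ f + (if f ℓ then 1 else 0)

-- number of edges of the subpath PQ (full loop, L n edges, if P = Q)
pathLen : ℕ → ℕ → ℕ → ℕ
pathLen n P Q = if P ≡ᵇ Q then L n else (L n + Q ∸ P) % L n

countOn : ℕ → (DEdge → Bool) → ℕ → ℕ → ℕ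
countOn n f P Q = count (pathLen n P Q) (λ t → f (edgeAt ((P + t) % L n)))

isHor : DEdge → Bool
isHor (hor _) = true
isHor (ver _) = false

isVer : DEdge → Bool
isVer (hor _) = false
isVer (ver _) = true

horIn : ∀ {n} → Subset (suc n) → DEdge → Bool
horIn S₁ (hor i) = lookupℕ S₁ i
horIn S₁ (ver _) = false

verIn : ∀ {n} → Subset n → DEdge → Bool
verIn S₂ (hor _) = false
verIn S₂ (ver j) = lookupℕ S₂ j

#hor #ver : ℕ → ℕ → ℕ → ℕ
#hor n = countOn n isHor
#ver n = countOn n isVer

#horIn : ∀ n → Subset (suc n) → ℕ → ℕ → ℕ
#horIn n S₁ = countOn n (horIn S₁)

#verIn : ∀ n → Subset n → ℕ → ℕ → ℕ
#verIn n S₂ = countOn n (verIn S₂)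

-- Compatibility.  u ∈ S₁ is the edge at position p (left endpoint E = p),
-- v ∈ S₂ is the edge at position q (upper endpoint F = q+1 mod L).
-- Points of (EF)° are (E + k) mod L for 0 < k < |EF|.
Compatible : ∀ n → Subset (suc n) × Subset n → Set
Compatible n (S₁ , S₂) =
  ∀ (p q i j : ℕ) → p < L n → q < L n →
  edgeAt p ≡ hor i → lookupℕ S₁ i ≡ true →
  edgeAt q ≡ ver j → lookupℕ S₂ j ≡ true →
  ∃[ k ] (0 < k × k < pathLen n p ((suc q) % L n) ×
    (#hor n ((p + k) % L n) ((suc q) % L n)
        ≡ 2 * #verIn n S₂ ((p + k) % L n) ((suc q) % L n)
     ⊎ #ver n p ((p + k) % L n) ≡ 2 * #horIn n S₁ p ((p + k) % L n)))

-- A perfect matching of the ladder H_m is determined by the set X of indices r with A_r A_{r+1} in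
-- it: B_r B_{r+1} is in it for the same r, the rungs are those at uncovered vertices, and X can be
-- any set of indices below m with no two consecutive.  φ splits X into its even and odd indices, so
-- the theorem amounts to: (S₁, S₂) is compatible iff the interleaving S₁ 0, S₂ 0, S₁ 1, S₂ 1, …
-- has no two consecutive members.  Necessity is read off three short subpaths.  For sufficiency,
-- take u ∈ S₁ and v ∈ S₂ with no admissible A on the subpath EF of length D: the prefix quantity
-- |(EA)_2| − 2|(EA)_1 ∩ S₁| starts negative and rises by at most one per step, so it stays ≤ 0 up to
-- F, and likewise for the suffix quantity; adding both gives D ≤ 2 · #(selected edges on EF).  A
-- potential function along the loop shows instead that 2 · #(selected edges) < D.

module Submission where

open import Defs
open import Data.Bool using (Bool; true; false; _∧_; not; if_then_else_; T)
open import Data.Nat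
open import Data.Nat.Properties
open import Data.Nat.DivMod
open import Data.Product using (_×_; _,_; proj₁; proj₂; ∃-syntax)
open import Data.Sum using (_⊎_; inj₁; inj₂)
open import Data.Empty using (⊥; ⊥-elim)
open import Data.Bool.Properties using (not-injective; ∧-zeroʳ; ∧-idem)
open import Data.Fin using (Fin; toℕ; fromℕ<; inject₁) renaming (suc to fsuc; zero to fzero)
import Data.Fin.Properties as Fin
open import Data.Fin.Properties using (toℕ-injective; toℕ-inject₁; inject₁-injective; toℕ-fromℕ<; toℕ<n; toℕ≤pred[n])
open import Data.Fin.Subset using (Subset)
open import Data.Vec using (Vec; []; _∷_; lookup; tabulate)
open import Data.Vec.Properties using (lookup∘tabulate; tabulate-cong; tabulate∘lookup)
open import Function using (_∘_; _⇔_; Equivalence; mk⇔)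
open import Function.Construct.Identity using (⇔-id)
open import Relation.Nullary using (yes; no)
open import Relation.Nullary.Decidable using (_×-dec_; _⊎-dec_)
open import Relation.Binary.PropositionalEquality
open import Data.Nat.Tactic.RingSolver using (solve-∀)
open import Algebra.Properties.CommutativeSemigroup +-commutativeSemigroup using (interchange)

2*n≡n+n : ∀ n → 2 * n ≡ n + n
2*n≡n+n n = cong (n +_) (+-identityʳ n)

twice-≤ : ∀ {a b} → a ≤ b → a + a ≤ 2 * b
twice-≤ {a} {b} a≤b = subst (a + a ≤_) (sym (2*n≡n+n b)) (+-mono-≤ a≤b a≤b)

twice-< : ∀ {a b} → a < b → a + a < 2 * b
twice-< {a} {b} a<b = subst (a + a <_) (sym (2*n≡n+n b)) (+-mono-< a<b a<b)

≤-twice : ∀ {a b} → a ≤ b → 2 * a ≤ b + b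
≤-twice {a} {b} a≤b = subst (_≤ b + b) (sym (2*n≡n+n a)) (+-mono-≤ a≤b a≤b)

twice-<⁻¹ : ∀ {a b} → a + a < 2 * b → a < b
twice-<⁻¹ lt = ≰⇒> (λ b≤a → <⇒≱ lt (≤-twice b≤a))

even-or-odd : ∀ m → ∃[ k ] (m ≡ k + k) ⊎ ∃[ k ] (m ≡ suc (k + k))
even-or-odd zero    = inj₁ (0 , refl)
even-or-odd (suc m) with even-or-odd m
... | inj₁ (k , refl) = inj₂ (k , refl)
... | inj₂ (k , refl) = inj₁ (suc k , cong suc (sym (+-suc k k)))

ind : Bool → ℕ
ind b = if b then 1 else 0

ind≤1 : ∀ b → ind b ≤ 1
ind≤1 true  = ≤-refl
ind≤1 false = z≤n

count-cong : ∀ m {f g : ℕ → Bool} → (∀ t → t < m → f t ≡ g t) → count m f ≡ count m g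
count-cong zero    eq = refl
count-cong (suc m) eq = cong₂ _+_ (count-cong m (λ t t<m → eq t (m<n⇒m<1+n t<m))) (cong ind (eq m ≤-refl))

count-+ : ∀ a b (f : ℕ → Bool) → count (a + b) f ≡ count a f + count b (λ t → f (a + t))
count-+ a zero    f rewrite +-identityʳ a = sym (+-identityʳ (count a f))
count-+ a (suc b) f rewrite +-suc a b | count-+ a b f =
  +-assoc (count a f) (count b (λ t → f (a + t))) (ind (f (a + b)))

count-suc-head : ∀ m (f : ℕ → Bool) → count (suc m) f ≡ ind (f 0) + count m (λ t → f (suc t))
count-suc-head m f = count-+ 1 m f

count-false : ∀ m (f : ℕ → Bool) → (∀ t → t < m → f t ≡ false) → count m f ≡ 0
count-false zero    f _  = refl
count-false (suc m) f ff rewrite count-false m f (λ t t<m → ff t (m<n⇒m<1+n t<m)) | ff m ≤-refl = refl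

count≤1 : ∀ m t₀ (f : ℕ → Bool) → (∀ t → t < m → f t ≡ true → t ≡ t₀) → count m f ≤ 1
count≤1 zero    t₀ f uniq = z≤n
count≤1 (suc m) t₀ f uniq with f m in fm
... | false = subst (_≤ 1) (sym (+-identityʳ _)) (count≤1 m t₀ f (λ t t<m → uniq t (m<n⇒m<1+n t<m)))
... | true  = ≤-reflexive (cong (_+ 1) (count-false m f earlier-false))
  where
  earlier-false : ∀ t → t < m → f t ≡ false
  earlier-false t t<m with f t in ft
  ... | false = refl
  ... | true  = ⊥-elim (<-irrefl (trans (uniq t (m<n⇒m<1+n t<m) ft) (sym (uniq m ≤-refl fm))) t<m)

ind-isHor+isVer : ∀ e → ind (isHor e) + ind (isVer e) ≡ 1
ind-isHor+isVer (hor _) = refl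
ind-isHor+isVer (ver _) = refl

count-isHor+isVer : ∀ m (e : ℕ → DEdge) → count m (isHor ∘ e) + count m (isVer ∘ e) ≡ m
count-isHor+isVer zero    e = refl
count-isHor+isVer (suc m) e = begin
  (count m (isHor ∘ e) + ind (isHor (e m))) + (count m (isVer ∘ e) + ind (isVer (e m)))
    ≡⟨ interchange (count m (isHor ∘ e)) _ _ _ ⟩
  (count m (isHor ∘ e) + count m (isVer ∘ e)) + (ind (isHor (e m)) + ind (isVer (e m)))
    ≡⟨ cong₂ _+_ (count-isHor+isVer m e) (ind-isHor+isVer (e m)) ⟩
  m + 1
    ≡⟨ +-comm m 1 ⟩
  suc m ∎
  where open ≡-Reasoning

-- F rises by at most one per step and 2G never decreases, so F − 2G cannot pass from
-- negative to positive without vanishing in between.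
no-crossing : ∀ d (F G : ℕ → ℕ) → (∀ k → k < d → F (suc k) ≤ suc (F k)) → (∀ k → k < d → G k ≤ G (suc k)) →
  F 1 < 2 * G 1 → (∀ k → 0 < k → k < d → F k ≢ 2 * G k) → 0 < d → F d ≤ 2 * G d
no-crossing (suc zero)    F G F-step G-mono start avoid _ = <⇒≤ start
no-crossing (suc (suc d)) F G F-step G-mono start avoid _ = step-below ≤-refl (below (suc d) (s≤s z≤n) ≤-refl)
  where
  step-below : ∀ {k} → k < suc (suc d) → F k < 2 * G k → F (suc k) ≤ 2 * G (suc k)
  step-below {k} k<d lt = ≤-trans (F-step k k<d) (≤-trans lt (*-monoʳ-≤ 2 (G-mono k k<d)))
  below : ∀ k → 0 < k → k < suc (suc d) → F k < 2 * G k
  below (suc zero)    _ _   = start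
  below (suc (suc k)) _ k<d = ≤∧≢⇒< (step-below (<-trans (n<1+n _) k<d) (below (suc k) (s≤s z≤n) (<-trans (n<1+n _) k<d)))
                                    (avoid (suc (suc k)) (s≤s z≤n) k<d)

prefix-no-crossing : ∀ d (a b : ℕ → Bool) → a 0 ≡ false → b 0 ≡ true →
  (∀ k → 0 < k → k < d → count k a ≢ 2 * count k b) → 0 < d → count d a ≤ 2 * count d b
prefix-no-crossing d a b a₀ b₀ =
  no-crossing d (λ k → count k a) (λ k → count k b) a-step b-step start
  where
  a-step : ∀ k → k < d → count (suc k) a ≤ suc (count k a)
  a-step k _ = subst (count (suc k) a ≤_) (+-comm (count k a) 1) (+-monoʳ-≤ (count k a) (ind≤1 (a k)))
  b-step : ∀ k → k < d → count k b ≤ count (suc k) b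
  b-step k _ = m≤m+n (count k b) _
  start : count 1 a < 2 * count 1 b
  start rewrite a₀ | b₀ = s≤s z≤n

count-suffix-suc : ∀ (a : ℕ → Bool) {d m} → m < d →
  count (suc m) (λ t → a (d ∸ suc m + t)) ≡ ind (a (d ∸ suc m)) + count m (λ t → a (d ∸ m + t))
count-suffix-suc a {d} {m} m<d = trans (count-suc-head m _)
  (cong₂ _+_ (cong (ind ∘ a) (+-identityʳ _))
             (count-cong m (λ t _ → cong a (trans (+-suc _ t) (cong (_+ t) (sym (+-∸-assoc 1 m<d)))))))

suffix-no-crossing : ∀ d (a b : ℕ → Bool) → a (pred d) ≡ false → b (pred d) ≡ true →
  (∀ k → 0 < k → k < d → count (d ∸ k) (λ t → a (k + t)) ≢ 2 * count (d ∸ k) (λ t → b (k + t))) →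
  0 < d → count d a ≤ 2 * count d b
suffix-no-crossing d@(suc d′) a b a-last b-last avoid 0<d =
  subst₂ (λ x y → x ≤ 2 * y) (whole a) (whole b)
    (no-crossing d (suffix a) (suffix b) a-step b-step start avoid′ 0<d)
  where
  suffix : (ℕ → Bool) → ℕ → ℕ
  suffix f m = count m (λ t → f (d ∸ m + t))
  whole : ∀ f → suffix f d ≡ count d f
  whole f = count-cong d (λ t _ → cong (λ c → f (c + t)) (n∸n≡0 d))
  a-step : ∀ m → m < d → suffix a (suc m) ≤ suc (suffix a m)
  a-step m m<d rewrite count-suffix-suc a m<d = +-monoˡ-≤ (suffix a m) (ind≤1 _)
  b-step : ∀ m → m < d → suffix b m ≤ suffix b (suc m)
  b-step m m<d rewrite count-suffix-suc b m<d = m≤n+m (suffix b m) _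
  start : suffix a 1 < 2 * suffix b 1
  start rewrite +-identityʳ d′ | a-last | b-last = s≤s z≤n
  avoid′ : ∀ m → 0 < m → m < d → suffix a m ≢ 2 * suffix b m
  avoid′ m 0<m m<d eq = avoid (d ∸ m) (m<n⇒0<n∸m m<d) (∸-monoʳ-< 0<m (<⇒≤ m<d))
    (subst (λ l → count l (λ t → a (d ∸ m + t)) ≡ 2 * count l (λ t → b (d ∸ m + t)))
           (sym (m∸[m∸n]≡n (<⇒≤ m<d))) eq)

-- Subpaths of the closed Dyck path

≡ᵇ-refl : ∀ m → (m ≡ᵇ m) ≡ true
≡ᵇ-refl zero    = refl
≡ᵇ-refl (suc m) = ≡ᵇ-refl m

≢⇒≡ᵇ-false : ∀ {m n} → m ≢ n → (m ≡ᵇ n) ≡ false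
≢⇒≡ᵇ-false {m} {n} m≢n with m ≡ᵇ n in eq
... | false = refl
... | true  = ⊥-elim (m≢n (≡ᵇ⇒≡ m n (subst T (sym eq) _)))

%-shift : ∀ n a t → (a % L n + t) % L n ≡ (a + t) % L n
%-shift n a t = begin
  (a % L n + t) % L n               ≡⟨ %-distribˡ-+ (a % L n) t (L n) ⟩
  (a % L n % L n + t % L n) % L n   ≡⟨ cong (λ x → (x + t % L n) % L n) (m%n%n≡m%n a (L n)) ⟩
  (a % L n + t % L n) % L n         ≡⟨ %-distribˡ-+ a t (L n) ⟨
  (a + t) % L n                     ∎
  where open ≡-Reasoning

suc-% : ∀ n a → suc (a % L n) % L n ≡ suc a % L n
suc-% n a = trans (cong (_% L n) (+-comm 1 (a % L n))) (trans (%-shift n a 1) (cong (_% L n) (+-comm a 1)))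

%-once-wrapped : ∀ n {x} → L n ≤ x → x < L n + L n → x % L n ≡ x ∸ L n
%-once-wrapped n {x} L≤x x<2L = begin
  x % L n                   ≡⟨ cong (_% L n) (m∸n+n≡m L≤x) ⟨
  (x ∸ L n + L n) % L n     ≡⟨ [m+n]%n≡m%n (x ∸ L n) (L n) ⟩
  (x ∸ L n) % L n           ≡⟨ m<n⇒m%n≡m (subst (x ∸ L n <_) (m+n∸n≡m (L n) (L n)) (∸-monoˡ-< x<2L L≤x)) ⟩
  x ∸ L n                   ∎
  where open ≡-Reasoning

pathLen-self : ∀ n a → pathLen n a a ≡ L n
pathLen-self n a rewrite ≡ᵇ-refl a = refl

pathLen-≢ : ∀ n {a b} → a ≢ b → pathLen n a b ≡ (L n + b ∸ a) % L n
pathLen-≢ n a≢b rewrite ≢⇒≡ᵇ-false a≢b = refl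

pathLen-+ : ∀ n a d → a < L n → 0 < d → d ≤ L n → pathLen n a ((a + d) % L n) ≡ d
pathLen-+ n a d a<L 0<d d≤L with a + d <? L n | m≤n⇒m<n∨m≡n d≤L
... | yes a+d<L | _ rewrite m<n⇒m%n≡m a+d<L = begin
  pathLen n a (a + d)             ≡⟨ pathLen-≢ n (<⇒≢ (m<m+n a 0<d)) ⟩
  (L n + (a + d) ∸ a) % L n       ≡⟨ cong (_% L n) (trans (+-∸-assoc (L n) (m≤m+n a d)) (cong (L n +_) (m+n∸m≡n a d))) ⟩
  (L n + d) % L n                 ≡⟨ cong (_% L n) (+-comm (L n) d) ⟩
  (d + L n) % L n                 ≡⟨ [m+n]%n≡m%n d (L n) ⟩
  d % L n                         ≡⟨ m<n⇒m%n≡m (≤-<-trans (m≤n+m d a) a+d<L) ⟩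
  d                               ∎
  where open ≡-Reasoning
... | no a+d≮L | inj₂ refl rewrite %-once-wrapped n (m≤n+m (L n) a) (+-monoˡ-< (L n) a<L)
                                 | m+n∸n≡m a (L n) = pathLen-self n a
... | no a+d≮L | inj₁ d<L rewrite %-once-wrapped n (≮⇒≥ a+d≮L) (+-mono-< a<L d<L) = begin
  pathLen n a r                   ≡⟨ pathLen-≢ n a≢r ⟩
  (L n + r ∸ a) % L n             ≡⟨ cong (λ x → (x ∸ a) % L n) L+r≡a+d ⟩
  (a + d ∸ a) % L n               ≡⟨ cong (_% L n) (m+n∸m≡n a d) ⟩
  d % L n                         ≡⟨ m<n⇒m%n≡m d<L ⟩
  d                               ∎
  where
  open ≡-Reasoning
  r : ℕ
  r = a + d ∸ L n
  L+r≡a+d : L n + r ≡ a + d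
  L+r≡a+d = m+[n∸m]≡n (≮⇒≥ a+d≮L)
  a≢r : a ≢ r
  a≢r a≡r = <⇒≢ d<L (+-cancelˡ-≡ a d (L n) (trans (sym L+r≡a+d) (trans (cong (L n +_) (sym a≡r)) (+-comm (L n) a))))

distance : ∀ n {p q} → p < L n → q < L n → ∃[ d ] (d < L n × (p + d) % L n ≡ q)
distance n {p} {q} p<L q<L with p ≤? q
... | yes p≤q = q ∸ p , ≤-<-trans (m∸n≤m q p) q<L , trans (cong (_% L n) (m+[n∸m]≡n p≤q)) (m<n⇒m%n≡m q<L)
... | no  p≰q = L n + q ∸ p , d<L , p+d%L≡q
  where
  p≤L+q : p ≤ L n + q
  p≤L+q = ≤-trans (<⇒≤ p<L) (m≤m+n (L n) q)
  d<L : L n + q ∸ p < L n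
  d<L = subst (L n + q ∸ p <_) (m+n∸n≡m (L n) p) (∸-monoˡ-< (+-monoʳ-< (L n) (≰⇒> p≰q)) p≤L+q)
  p+d%L≡q : (p + (L n + q ∸ p)) % L n ≡ q
  p+d%L≡q = begin
    (p + (L n + q ∸ p)) % L n   ≡⟨ cong (_% L n) (m+[n∸m]≡n p≤L+q) ⟩
    (L n + q) % L n             ≡⟨ cong (_% L n) (+-comm (L n) q) ⟩
    (q + L n) % L n             ≡⟨ [m+n]%n≡m%n q (L n) ⟩
    q % L n                     ≡⟨ m<n⇒m%n≡m q<L ⟩
    q                           ∎
    where open ≡-Reasoning

pathEdge : ℕ → ℕ → ℕ → DEdge
pathEdge n p t = edgeAt ((p + t) % L n)

countOn-prefix : ∀ n f {p k} → p < L n → 0 < k → k ≤ L n →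
  countOn n f p ((p + k) % L n) ≡ count k (f ∘ pathEdge n p)
countOn-prefix n f p<L 0<k k≤L rewrite pathLen-+ n _ _ p<L 0<k k≤L = refl

countOn-suffix : ∀ n f {p k d} → 0 < k → k < d → d ≤ L n →
  countOn n f ((p + k) % L n) ((p + d) % L n) ≡ count (d ∸ k) (λ t → f (pathEdge n p (k + t)))
countOn-suffix n f {p} {k} {d} 0<k k<d d≤L =
  trans (cong (λ l → count l (λ t → f (edgeAt (((p + k) % L n + t) % L n)))) length)
        (count-cong (d ∸ k) (λ t _ → cong (f ∘ edgeAt) (trans (%-shift n (p + k) t) (cong (_% L n) (+-assoc p k t)))))
  where
  end : ((p + k) % L n + (d ∸ k)) % L n ≡ (p + d) % L n
  end = trans (%-shift n (p + k) (d ∸ k)) (cong (_% L n) (trans (+-assoc p k (d ∸ k)) (cong (p +_) (m+[n∸m]≡n (<⇒≤ k<d)))))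
  length : pathLen n ((p + k) % L n) ((p + d) % L n) ≡ d ∸ k
  length = trans (cong (pathLen n ((p + k) % L n)) (sym end))
                 (pathLen-+ n _ (d ∸ k) (m%n<n (p + k) (L n)) (m<n⇒0<n∸m k<d) (≤-trans (m∸n≤m d k) d≤L))

wrap-unique : ∀ n {p t} → p < L n → t < L n → (p + t) % L n ≡ 0 → t ≡ (L n ∸ p) % L n
wrap-unique n {p} {t} p<L t<L wrapped with p + t <? L n
... | yes p+t<L with m+n≡0⇒m≡0 p (trans (sym (m<n⇒m%n≡m p+t<L)) wrapped)
                   | m+n≡0⇒n≡0 p (trans (sym (m<n⇒m%n≡m p+t<L)) wrapped)
...   | refl | refl = sym (n%n≡0 (L n))
wrap-unique n {p} {t} p<L t<L wrapped | no p+t≮L = trans t≡L∸p (sym (m<n⇒m%n≡m L∸p<L))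
  where
  p+t≡L : p + t ≡ L n
  p+t≡L = ≤-antisym (m∸n≡0⇒m≤n (trans (sym (%-once-wrapped n (≮⇒≥ p+t≮L) (+-mono-< p<L t<L))) wrapped)) (≮⇒≥ p+t≮L)
  t≡L∸p : t ≡ L n ∸ p
  t≡L∸p = trans (sym (m+n∸m≡n p t)) (cong (_∸ p) p+t≡L)
  0<p : 0 < p
  0<p = n≢0⇒n>0 (λ p≡0 → <-irrefl (subst (λ x → x + t ≡ L n) p≡0 p+t≡L) t<L)
  L∸p<L : L n ∸ p < L n
  L∸p<L = ∸-monoʳ-< 0<p (<⇒≤ p<L)

count-wraps≤1 : ∀ n {p d} → p < L n → d ≤ L n → count d (λ t → (p + t) % L n ≡ᵇ 0) ≤ 1
count-wraps≤1 n {p} {d} p<L d≤L = count≤1 d ((L n ∸ p) % L n) _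
  (λ t t<d wraps → wrap-unique n p<L (<-≤-trans t<d d≤L) (≡ᵇ⇒≡ _ 0 (subst T (sym wraps) _)))

-- Compatible pairs

interleave : {A : Set} → (ℕ → A) → (ℕ → A) → ℕ → A
interleave f g zero    = f 0
interleave f g (suc r) = interleave g (f ∘ suc) r

interleave-even : ∀ {A : Set} (f g : ℕ → A) k → interleave f g (k + k) ≡ f k
interleave-odd  : ∀ {A : Set} (f g : ℕ → A) k → interleave f g (suc (k + k)) ≡ g k
interleave-even f g zero    = refl
interleave-even f g (suc k) rewrite +-suc k k = interleave-odd g (f ∘ suc) k
interleave-odd  f g k = interleave-even g (f ∘ suc) k

Sparse : (ℕ → Bool) → Set
Sparse X = ∀ r → X r ∧ X (suc r) ≡ false

sparse-interleave : ∀ (f g : ℕ → Bool) → (∀ k → f k ∧ g k ≡ false) → (∀ k → g k ∧ f (suc k) ≡ false) →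
  Sparse (interleave f g)
sparse-interleave f g fg gf zero    = fg 0
sparse-interleave f g fg gf (suc r) = sparse-interleave g (f ∘ suc) gf (fg ∘ suc) r

sparse-even : ∀ {f g : ℕ → Bool} → Sparse (interleave f g) → ∀ k → f k ∧ g k ≡ false
sparse-even {f} {g} sparse k =
  trans (sym (cong₂ _∧_ (interleave-even f g k) (interleave-odd f g k))) (sparse (k + k))

sparse-odd : ∀ {f g : ℕ → Bool} → Sparse (interleave f g) → ∀ k → g k ∧ f (suc k) ≡ false
sparse-odd {f} {g} sparse k = trans (sym (cong₂ _∧_ (interleave-odd f g k) even-suc)) (sparse (suc (k + k)))
  where
  even-suc : interleave f g (suc (suc (k + k))) ≡ f (suc k)
  even-suc = trans (cong (interleave f g ∘ suc) (sym (+-suc k k))) (interleave-even f g (suc k))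

edgeAt-hor : ∀ k → edgeAt (suc (k + k)) ≡ hor (suc k)
edgeAt-hor zero    = refl
edgeAt-hor (suc k) rewrite +-suc k k | edgeAt-hor k = refl

edgeAt-ver : ∀ k → edgeAt (suc (suc (k + k))) ≡ ver k
edgeAt-ver zero    = refl
edgeAt-ver (suc k) rewrite +-suc k k | edgeAt-ver k = refl

-- Positions on the loop: 0 carries u₀, 2k+1 carries u_{k+1} and 2k+2 carries v_{k+1}.
data Position (n : ℕ) : ℕ → Set where
  at-u₀ : Position n 0
  at-hor : ∀ k → k < n → Position n (suc (k + k))
  at-ver : ∀ k → k < n → Position n (suc (suc (k + k)))

position : ∀ n r → r < L n → Position n r
position n zero    _ = at-u₀
position n (suc m) r<L with even-or-odd m
... | inj₁ (k , refl) = at-hor k (twice-<⁻¹ (s≤s⁻¹ r<L))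
... | inj₂ (k , refl) = at-ver k (twice-<⁻¹ (<-trans (n<1+n (k + k)) (s≤s⁻¹ r<L)))

lookupℕ-true⇒< : ∀ {m} (v : Vec Bool m) k → lookupℕ v k ≡ true → k < m
lookupℕ-true⇒< (_ ∷ _) zero    _ = s≤s z≤n
lookupℕ-true⇒< (_ ∷ v) (suc k) b = s≤s (lookupℕ-true⇒< v k b)

odd-bound : ∀ {k n} → k < n → suc (k + k) + 2 ≤ L n
odd-bound {k} {n} k<n = subst (_≤ L n) (sym (shape k)) (s≤s (twice-≤ k<n))
  where
  shape : ∀ k → suc (k + k) + 2 ≡ suc (suc k + suc k)
  shape = solve-∀

module DyckPair (n : ℕ) (S₁ : Subset (suc n)) (S₂ : Subset n) where

  s₁ s₂ : ℕ → Bool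
  s₁ = lookupℕ S₁
  s₂ = lookupℕ S₂

  Witness : ℕ → ℕ → ℕ → Set
  Witness p F k = #hor n ((p + k) % L n) F ≡ 2 * #verIn n S₂ ((p + k) % L n) F
                ⊎ #ver n p ((p + k) % L n) ≡ 2 * #horIn n S₁ p ((p + k) % L n)

  Balanced : (ℕ → DEdge) → ℕ → ℕ → Set
  Balanced e D k = count (D ∸ k) (λ t → isHor (e (k + t))) ≡ 2 * count (D ∸ k) (λ t → verIn S₂ (e (k + t)))
                 ⊎ count k (isVer ∘ e) ≡ 2 * count k (horIn S₁ ∘ e)

  witness⇔balanced : ∀ {p k D} → p < L n → 0 < k → k < D → D ≤ L n →
    Witness p ((p + D) % L n) k ⇔ Balanced (pathEdge n p) D k
  witness⇔balanced {p} p<L 0<k k<D D≤L = transport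
    (countOn-suffix n isHor {p} 0<k k<D D≤L) (countOn-suffix n (verIn S₂) {p} 0<k k<D D≤L)
    (countOn-prefix n isVer p<L 0<k (<⇒≤ (<-≤-trans k<D D≤L)))
    (countOn-prefix n (horIn S₁) p<L 0<k (<⇒≤ (<-≤-trans k<D D≤L)))
    where
    transport : ∀ {a a′ b b′ c c′ d d′ : ℕ} → a ≡ a′ → b ≡ b′ → c ≡ c′ → d ≡ d′ →
      (a ≡ 2 * b ⊎ c ≡ 2 * d) ⇔ (a′ ≡ 2 * b′ ⊎ c′ ≡ 2 * d′)
    transport refl refl refl refl = ⇔-id _

  balanced-cong : ∀ {e e′ D k} → (∀ t → t < D → e t ≡ e′ t) → k < D → Balanced e D k → Balanced e′ D k
  balanced-cong {e} {e′} {D} {k} e≗e′ k<D (inj₁ eq) = inj₁ (begin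
    count (D ∸ k) (λ t → isHor (e′ (k + t)))        ≡⟨ count-cong (D ∸ k) (λ t t< → cong isHor (e≗e′ _ (in-range t t<))) ⟨
    count (D ∸ k) (λ t → isHor (e (k + t)))         ≡⟨ eq ⟩
    2 * count (D ∸ k) (λ t → verIn S₂ (e (k + t)))  ≡⟨ cong (2 *_) (count-cong (D ∸ k) (λ t t< → cong (verIn S₂) (e≗e′ _ (in-range t t<)))) ⟩
    2 * count (D ∸ k) (λ t → verIn S₂ (e′ (k + t))) ∎)
    where
    open ≡-Reasoning
    in-range : ∀ t → t < D ∸ k → k + t < D
    in-range t t< = subst (k + t <_) (m+[n∸m]≡n (<⇒≤ k<D)) (+-monoʳ-< k t<)
  balanced-cong {e} {e′} {D} {k} e≗e′ k<D (inj₂ eq) = inj₂ (begin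
    count k (isVer ∘ e′)        ≡⟨ count-cong k (λ t t<k → cong isVer (e≗e′ t (<-trans t<k k<D))) ⟨
    count k (isVer ∘ e)         ≡⟨ eq ⟩
    2 * count k (horIn S₁ ∘ e)  ≡⟨ cong (2 *_) (count-cong k (λ t t<k → cong (horIn S₁) (e≗e′ t (<-trans t<k k<D)))) ⟩
    2 * count k (horIn S₁ ∘ e′) ∎)
    where open ≡-Reasoning

  module _ (sparse : Sparse (interleave s₁ s₂)) where

    selected : DEdge → ℕ
    selected e = ind (horIn S₁ e) + ind (verIn S₂ e)

    -- Potentials of the lattice points A_{k+1} (position 2k+1, and 0 for k = n) and B_{k+1}
    -- (position 2k+2).  Along the loop, 2 · #selected + potential grows by at most one per edge
    -- (by two on the edge u₀); it is at most 1 after a selected u and exactly 3 after a selected v.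
    potentialA potentialB : ℕ → ℕ
    potentialA k = 2 * ind (not (s₁ k)) + 1
    potentialB k = if s₁ (suc k) then 0 else (if s₂ k then 4 else 2)

    potential : ℕ → ℕ
    potential zero    = potentialA n
    potential (suc r) = interleave potentialA potentialB r

    potential-A : ∀ k → k ≤ n → potential (suc (k + k) % L n) ≡ potentialA k
    potential-A k k≤n with m≤n⇒m<n∨m≡n k≤n
    ... | inj₂ refl = cong potential (trans (cong (_% L k) (cong suc (sym (2*n≡n+n k)))) (n%n≡0 (L k)))
    ... | inj₁ k<n  = trans (cong potential (m<n⇒m%n≡m (s≤s (twice-< k<n))))
                            (interleave-even potentialA potentialB k)

    potential-B : ∀ k → k < n → potential (suc (suc (k + k)) % L n) ≡ potentialB k
    potential-B k k<n = trans (cong potential (m<n⇒m%n≡m (s≤s (subst (_≤ 2 * n) (cong suc (+-suc k k)) (twice-≤ k<n)))))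
                              (interleave-odd potentialA potentialB k)

    potential-after-ver : ∀ k → k < n → potential (suc (suc (suc (k + k))) % L n) ≡ potentialA (suc k)
    potential-after-ver k k<n =
      trans (cong (λ x → potential (suc (suc x) % L n)) (sym (+-suc k k))) (potential-A (suc k) k<n)

    private
      evaluate : ∀ {a b} → T (a ≤ᵇ b) → a ≤ b
      evaluate = ≤ᵇ⇒≤ _ _

    potential-step : ∀ r → r < L n →
      2 * selected (edgeAt r) + potential (suc r % L n) ≤ 1 + potential r + ind (r ≡ᵇ 0)
    potential-step r r<L with position n r r<L
    ... | at-u₀ rewrite potential-A 0 z≤n with s₁ 0 | s₁ n
    ...   | true  | true  = evaluate _
    ...   | true  | false = evaluate _
    ...   | false | true  = evaluate _
    ...   | false | false = evaluate _
    potential-step r r<L | at-hor k k<n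
      rewrite edgeAt-hor k | potential-B k k<n | interleave-even potentialA potentialB k
      with s₁ (suc k) | s₂ k | s₁ k | sparse-even sparse k
    ... | true  | _     | true  | _ = evaluate _
    ... | true  | _     | false | _ = evaluate _
    ... | false | true  | false | _ = evaluate _
    ... | false | false | true  | _ = evaluate _
    ... | false | false | false | _ = evaluate _
    potential-step r r<L | at-ver k k<n
      rewrite edgeAt-ver k | potential-after-ver k k<n | interleave-odd potentialA potentialB k
      with s₁ (suc k) | s₂ k | sparse-odd sparse k
    ... | true  | false | _ = evaluate _
    ... | false | true  | _ = evaluate _
    ... | false | false | _ = evaluate _

    potential-step-selected-hor : ∀ r i → r < L n → edgeAt r ≡ hor i → s₁ i ≡ true →
      2 * selected (edgeAt r) + potential (suc r % L n) ≤ 2 + ind (r ≡ᵇ 0)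
    potential-step-selected-hor r i r<L edge ∈S₁ with position n r r<L
    ... | at-u₀ rewrite potential-A 0 z≤n with edge
    ...   | refl rewrite ∈S₁ = evaluate _
    potential-step-selected-hor r i r<L edge ∈S₁ | at-hor k k<n rewrite edgeAt-hor k | potential-B k k<n with edge
    ... | refl rewrite ∈S₁ = evaluate _
    potential-step-selected-hor r i r<L edge ∈S₁ | at-ver k k<n rewrite edgeAt-ver k with edge
    ... | ()

    potential-after-selected-ver : ∀ q j → q < L n → edgeAt q ≡ ver j → s₂ j ≡ true → potential (suc q % L n) ≡ 3
    potential-after-selected-ver q j q<L edge j∈S₂ with position n q q<L
    ... | at-u₀ with edge
    ...   | ()
    potential-after-selected-ver q j q<L edge j∈S₂ | at-hor k k<n rewrite edgeAt-hor k with edge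
    ... | ()
    potential-after-selected-ver q j q<L edge j∈S₂ | at-ver k k<n
      rewrite edgeAt-ver k | potential-after-ver k k<n with edge
    ... | refl with s₁ (suc k) | sparse-odd sparse k
    ...   | false | _ = refl
    ...   | true  | conflict rewrite j∈S₂ with conflict
    ...     | ()

    private
      ≤-telescope : ∀ {x y P P′ M w} → x + P ≤ M → y + P′ ≤ 1 + P + w → x + y + P′ ≤ M + 1 + w
      ≤-telescope {x} {y} {P} {P′} {M} {w} x+P≤M y+P′≤ = +-cancelʳ-≤ P (x + y + P′) (M + 1 + w)
        (subst₂ _≤_ (rearrangeˡ x y P P′) (rearrangeʳ M P w) (+-mono-≤ x+P≤M y+P′≤))
        where
        rearrangeˡ : ∀ x y P P′ → x + P + (y + P′) ≡ x + y + P′ + P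
        rearrangeˡ = solve-∀
        rearrangeʳ : ∀ M P w → M + (1 + P + w) ≡ M + 1 + w + P
        rearrangeʳ = solve-∀

    module Walk (p : ℕ) (p<L : p < L n) where

      #u #v #wraps : ℕ → ℕ
      #u t     = count t (horIn S₁ ∘ pathEdge n p)
      #v t     = count t (verIn S₂ ∘ pathEdge n p)
      #wraps t = count t (λ t → (p + t) % L n ≡ᵇ 0)

      potential-sum : ∀ i → edgeAt p ≡ hor i → s₁ i ≡ true → ∀ t →
        2 * (#u (suc t) + #v (suc t)) + potential ((p + suc t) % L n) ≤ suc t + 1 + #wraps (suc t)
      potential-sum i edge i∈S₁ zero rewrite +-identityʳ p | m<n⇒m%n≡m p<L | +-comm p 1 =
        potential-step-selected-hor p i p<L edge i∈S₁
      potential-sum i edge i∈S₁ (suc t) = subst₂ _≤_ regroupˡ (regroupʳ t (#wraps (suc t)) (ind (r ≡ᵇ 0)))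
        (≤-telescope (potential-sum i edge i∈S₁ t) step)
        where
        r : ℕ
        r = (p + suc t) % L n
        step : 2 * selected (edgeAt r) + potential ((p + suc (suc t)) % L n) ≤ 1 + potential r + ind (r ≡ᵇ 0)
        step = subst (λ x → 2 * selected (edgeAt r) + potential x ≤ 1 + potential r + ind (r ≡ᵇ 0))
                     (trans (suc-% n (p + suc t)) (cong (_% L n) (sym (+-suc p (suc t)))))
                     (potential-step r (m%n<n (p + suc t) (L n)))
        regroupʳ : ∀ t w b → suc t + 1 + w + 1 + b ≡ suc (suc t) + 1 + (w + b)
        regroupʳ = solve-∀
        regroupˡ : 2 * (#u (suc t) + #v (suc t)) + 2 * selected (edgeAt r) + potential ((p + suc (suc t)) % L n)
                 ≡ 2 * (#u (suc (suc t)) + #v (suc (suc t))) + potential ((p + suc (suc t)) % L n)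
        regroupˡ = cong (_+ potential ((p + suc (suc t)) % L n))
                        (distribute (#u (suc t)) (#v (suc t)) (ind (horIn S₁ (edgeAt r))) (ind (verIn S₂ (edgeAt r))))
          where
          distribute : ∀ a b c d → 2 * (a + b) + 2 * (c + d) ≡ 2 * ((a + c) + (b + d))
          distribute = solve-∀

      twice-selected<length : ∀ i j d → d < L n → edgeAt p ≡ hor i → s₁ i ≡ true →
        pathEdge n p d ≡ ver j → s₂ j ≡ true → 2 * (#u (suc d) + #v (suc d)) + 3 ≤ suc d + 2
      twice-selected<length i j d d<L edge i∈S₁ last j∈S₂ = begin
        2 * (#u (suc d) + #v (suc d)) + 3                                   ≡⟨ cong (2 * (#u (suc d) + #v (suc d)) +_) end-potential ⟨
        2 * (#u (suc d) + #v (suc d)) + potential ((p + suc d) % L n)       ≤⟨ potential-sum i edge i∈S₁ d ⟩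
        suc d + 1 + #wraps (suc d)                                          ≤⟨ +-monoʳ-≤ (suc d + 1) (count-wraps≤1 n p<L d<L) ⟩
        suc d + 1 + 1                                                       ≡⟨ +-assoc (suc d) 1 1 ⟩
        suc d + 2                                                           ∎
        where
        open ≤-Reasoning
        end-potential : potential ((p + suc d) % L n) ≡ 3
        end-potential = begin-equality
          potential ((p + suc d) % L n)            ≡⟨ cong (λ x → potential (x % L n)) (+-suc p d) ⟩
          potential (suc (p + d) % L n)            ≡⟨ cong potential (suc-% n (p + d)) ⟨
          potential (suc ((p + d) % L n) % L n)    ≡⟨ potential-after-selected-ver _ j (m%n<n (p + d) (L n)) last j∈S₂ ⟩
          3                                        ∎

    witness : ∀ p i j d → p < L n → d < L n → edgeAt p ≡ hor i → s₁ i ≡ true →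
      pathEdge n p d ≡ ver j → s₂ j ≡ true → ∃[ k ] (0 < k × k < suc d × Witness p ((p + suc d) % L n) k)
    witness p i j d p<L d<L edge i∈S₁ last j∈S₂
      with anyUpTo? (λ k → 0 <? k ×-dec ((_ ≟ _) ⊎-dec (_ ≟ _))) (suc d)
    ... | yes (k , k<D , 0<k , b) = k , 0<k , k<D , Equivalence.from (witness⇔balanced p<L 0<k k<D d<L) b
    ... | no unbalanced = ⊥-elim (<-irrefl refl (+-cancelˡ-≤ (2 * (#u D + #v D)) 3 2 (begin
          2 * (#u D + #v D) + 3   ≤⟨ twice-selected<length i j d d<L edge i∈S₁ last j∈S₂ ⟩
          D + 2                   ≤⟨ +-monoˡ-≤ 2 D≤2[#u+#v] ⟩
          2 * (#u D + #v D) + 2   ∎)))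
      where
      open ≤-Reasoning
      open Walk p p<L
      D : ℕ
      D = suc d
      e : ℕ → DEdge
      e = pathEdge n p
      first : e 0 ≡ hor i
      first = trans (cong edgeAt (trans (cong (_% L n) (+-identityʳ p)) (m<n⇒m%n≡m p<L))) edge
      #ver≤2#u : count D (isVer ∘ e) ≤ 2 * #u D
      #ver≤2#u = prefix-no-crossing D (isVer ∘ e) (horIn S₁ ∘ e) (cong isVer first)
        (trans (cong (horIn S₁) first) i∈S₁) (λ k 0<k k<D eq → unbalanced (k , k<D , 0<k , inj₂ eq)) (s≤s z≤n)
      #hor≤2#v : count D (isHor ∘ e) ≤ 2 * #v D
      #hor≤2#v = suffix-no-crossing D (isHor ∘ e) (verIn S₂ ∘ e) (cong isHor last)
        (trans (cong (verIn S₂) last) j∈S₂) (λ k 0<k k<D eq → unbalanced (k , k<D , 0<k , inj₁ eq)) (s≤s z≤n)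
      D≤2[#u+#v] : D ≤ 2 * (#u D + #v D)
      D≤2[#u+#v] = begin
        D                                             ≡⟨ count-isHor+isVer D e ⟨
        count D (isHor ∘ e) + count D (isVer ∘ e)     ≤⟨ +-mono-≤ #hor≤2#v #ver≤2#u ⟩
        2 * #v D + 2 * #u D                           ≡⟨ +-comm (2 * #v D) (2 * #u D) ⟩
        2 * #u D + 2 * #v D                           ≡⟨ *-distribˡ-+ 2 (#u D) (#v D) ⟨
        2 * (#u D + #v D)                             ∎

    sparse⇒compatible : Compatible n (S₁ , S₂)
    sparse⇒compatible p q i j p<L q<L edge-p i∈S₁ edge-q j∈S₂ with distance n p<L q<L
    ... | d , d<L , p+d≡q with witness p i j d p<L d<L edge-p i∈S₁ (trans (cong edgeAt p+d≡q) edge-q) j∈S₂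
    ...   | k , 0<k , k<D , w = subst (λ F → ∃[ k ] (0 < k × k < pathLen n p F × Witness p F k)) end
            (k , 0<k , subst (k <_) (sym (pathLen-+ n p (suc d) p<L (s≤s z≤n) d<L)) k<D , w)
      where
      end : (p + suc d) % L n ≡ suc q % L n
      end = begin
        (p + suc d) % L n          ≡⟨ cong (_% L n) (+-suc p d) ⟩
        suc (p + d) % L n          ≡⟨ suc-% n (p + d) ⟨
        suc ((p + d) % L n) % L n  ≡⟨ cong (λ x → suc x % L n) p+d≡q ⟩
        suc q % L n                ∎
        where open ≡-Reasoning

  balanced-short : Compatible n (S₁ , S₂) → ∀ p d i j (g : ℕ → DEdge) → p + suc d ≤ L n →
    (∀ t → t ≤ d → edgeAt (t + p) ≡ g t) → g 0 ≡ hor i → s₁ i ≡ true → g d ≡ ver j → s₂ j ≡ true →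
    ∃[ k ] (0 < k × k < suc d × Balanced g (suc d) k)
  balanced-short compatible p d i j g p+D≤L g-edges first i∈S₁ last j∈S₂ =
    conclude (compatible p (p + d) i j p<L q<L (trans (g-edges 0 z≤n) first) i∈S₁
                         (trans (cong edgeAt (+-comm p d)) (trans (g-edges d ≤-refl) last)) j∈S₂)
    where
    q<L : p + d < L n
    q<L = subst (_≤ L n) (+-suc p d) p+D≤L
    p<L : p < L n
    p<L = ≤-<-trans (m≤m+n p d) q<L
    D≤L : suc d ≤ L n
    D≤L = ≤-trans (m≤n+m _ p) p+D≤L
    end : suc (p + d) % L n ≡ (p + suc d) % L n
    end = cong (_% L n) (sym (+-suc p d))
    on-path : ∀ t → t < suc d → pathEdge n p t ≡ g t
    on-path t t<D = trans (cong edgeAt (trans (m<n⇒m%n≡m (<-≤-trans (+-monoʳ-< p t<D) p+D≤L)) (+-comm p t)))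
                          (g-edges t (s≤s⁻¹ t<D))
    conclude : ∃[ k ] (0 < k × k < pathLen n p (suc (p + d) % L n) × Witness p (suc (p + d) % L n) k) →
               ∃[ k ] (0 < k × k < suc d × Balanced g (suc d) k)
    conclude (k , 0<k , k<len , w) = k , 0<k , k<D ,
      balanced-cong on-path k<D (Equivalence.to (witness⇔balanced p<L 0<k k<D D≤L) (subst (λ F → Witness p F k) end w))
      where
      k<D : k < suc d
      k<D = subst (k <_) (trans (cong (pathLen n p) end) (pathLen-+ n p (suc d) p<L (s≤s z≤n) D≤L)) k<len

  private
    odd≢even : ∀ {m} → 1 ≢ 2 * m
    odd≢even {m} eq = even≢odd m 0 (sym eq)

    0≢twice-selected : ∀ {b} → b ≡ true → 0 ≢ 2 * ind b
    0≢twice-selected refl ()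

    0≢twice-selected+ : ∀ {b x} → b ≡ true → 0 ≢ 2 * (ind b + x)
    0≢twice-selected+ refl ()

  compatible⇒sparse : Compatible n (S₁ , S₂) → Sparse (interleave s₁ s₂)
  compatible⇒sparse compatible = sparse-interleave s₁ s₂ u-v v-u
    where
    -- v_{k+1} directly follows u_{k+1} on the path.
    v-u : ∀ k → s₂ k ∧ s₁ (suc k) ≡ false
    v-u k with s₂ k in j∈S₂ | s₁ (suc k) in i∈S₁
    ... | false | _     = refl
    ... | true  | false = refl
    ... | true  | true  = ⊥-elim (refute (balanced-short compatible (suc (k + k)) 1 (suc k) k g
                                   (odd-bound (lookupℕ-true⇒< S₂ k j∈S₂)) g-edges refl i∈S₁ refl j∈S₂))
      where
      g : ℕ → DEdge
      g zero    = hor (suc k)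
      g (suc _) = ver k
      g-edges : ∀ t → t ≤ 1 → edgeAt (t + suc (k + k)) ≡ g t
      g-edges zero          _ = edgeAt-hor k
      g-edges (suc zero)    _ = edgeAt-ver k
      g-edges (suc (suc t)) (s≤s ())
      refute : ∃[ m ] (0 < m × m < 2 × Balanced g 2 m) → ⊥
      refute (1 , _ , _ , inj₁ w) = 0≢twice-selected j∈S₂ w
      refute (1 , _ , _ , inj₂ w) = 0≢twice-selected i∈S₁ w
      refute (suc (suc _) , _ , s≤s (s≤s ()) , _)
    -- u_k starts a subpath of four edges (three for k = 0) ending with v_{k+1}.
    u-v : ∀ k → s₁ k ∧ s₂ k ≡ false
    u-v k with s₁ k in i∈S₁ | s₂ k in j∈S₂
    ... | false | _     = refl
    ... | true  | false = refl
    u-v zero | true | true = ⊥-elim (refute (balanced-short compatible 0 2 0 0 g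
                               (odd-bound (lookupℕ-true⇒< S₂ 0 j∈S₂)) g-edges refl i∈S₁ refl j∈S₂))
      where
      g : ℕ → DEdge
      g zero          = hor 0
      g (suc zero)    = hor 1
      g (suc (suc _)) = ver 0
      g-edges : ∀ t → t ≤ 2 → edgeAt (t + 0) ≡ g t
      g-edges zero                _ = refl
      g-edges (suc zero)          _ = refl
      g-edges (suc (suc zero))    _ = refl
      g-edges (suc (suc (suc t))) (s≤s (s≤s ()))
      refute : ∃[ m ] (0 < m × m < 3 × Balanced g 3 m) → ⊥
      refute (1 , _ , _ , inj₁ w) = odd≢even {count 2 (λ t → verIn S₂ (g (1 + t)))} w
      refute (1 , _ , _ , inj₂ w) = 0≢twice-selected i∈S₁ w
      refute (2 , _ , _ , inj₁ w) = 0≢twice-selected j∈S₂ w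
      refute (2 , _ , _ , inj₂ w) = 0≢twice-selected+ i∈S₁ w
      refute (suc (suc (suc _)) , _ , s≤s (s≤s (s≤s ())) , _)
    u-v (suc k) | true | true = ⊥-elim (refute (balanced-short compatible (suc (k + k)) 3 (suc k) (suc k) g
                                  bound g-edges refl i∈S₁ refl j∈S₂))
      where
      bound : suc (k + k) + 4 ≤ L n
      bound = subst (_≤ L n) (shape k) (odd-bound (lookupℕ-true⇒< S₂ (suc k) j∈S₂))
        where
        shape : ∀ k → suc (suc k + suc k) + 2 ≡ suc (k + k) + 4
        shape = solve-∀
      g : ℕ → DEdge
      g zero                = hor (suc k)
      g (suc zero)          = ver k
      g (suc (suc zero))    = hor (suc (suc k))
      g (suc (suc (suc _))) = ver (suc k)
      g-edges : ∀ t → t ≤ 3 → edgeAt (t + suc (k + k)) ≡ g t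
      g-edges zero                      _ = edgeAt-hor k
      g-edges (suc zero)                _ = edgeAt-ver k
      g-edges (suc (suc zero))          _ = cong bump (edgeAt-hor k)
      g-edges (suc (suc (suc zero)))    _ = cong bump (edgeAt-ver k)
      g-edges (suc (suc (suc (suc t)))) (s≤s (s≤s (s≤s ())))
      refute : ∃[ m ] (0 < m × m < 4 × Balanced g 4 m) → ⊥
      refute (1 , _ , _ , inj₁ w) = odd≢even {count 3 (λ t → verIn S₂ (g (1 + t)))} w
      refute (1 , _ , _ , inj₂ w) = 0≢twice-selected i∈S₁ w
      refute (2 , _ , _ , inj₁ w) = odd≢even {count 2 (λ t → verIn S₂ (g (2 + t)))} w
      refute (2 , _ , _ , inj₂ w) = odd≢even {count 2 (horIn S₁ ∘ g)} w
      refute (3 , _ , _ , inj₁ w) = 0≢twice-selected j∈S₂ w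
      refute (3 , _ , _ , inj₂ w) = odd≢even {count 3 (horIn S₁ ∘ g)} w
      refute (suc (suc (suc (suc _))) , _ , s≤s (s≤s (s≤s (s≤s ()))) , _)

-- Perfect matchings of the ladder

before : (ℕ → Bool) → ℕ → Bool
before X zero    = false
before X (suc c) = X c

data Slot : Set where
  behind across ahead : Slot

slots : Bool → Bool → Bool → Slot → Bool
slots a r b behind = a
slots a r b across = r
slots a r b ahead  = b

ExactlyOne : (Slot → Bool) → Set
ExactlyOne f = (∃[ s ] f s ≡ true) × (∀ {s s′} → f s ≡ true → f s′ ≡ true → s ≡ s′)

exactlyOne⇒ : ∀ a r b → ExactlyOne (slots a r b) → a ∧ b ≡ false × r ≡ not a ∧ not b
exactlyOne⇒ true  true  _     (_ , unique) with unique {behind} {across} refl refl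
... | ()
exactlyOne⇒ true  false true  (_ , unique) with unique {behind} {ahead} refl refl
... | ()
exactlyOne⇒ true  false false _ = refl , refl
exactlyOne⇒ false true  true  (_ , unique) with unique {across} {ahead} refl refl
... | ()
exactlyOne⇒ false true  false _ = refl , refl
exactlyOne⇒ false false true  _ = refl , refl
exactlyOne⇒ false false false ((behind , ()) , _)
exactlyOne⇒ false false false ((across , ()) , _)
exactlyOne⇒ false false false ((ahead  , ()) , _)

only : ∀ {f : Slot → Bool} {s₀} → (∀ {s} → f s ≡ true → s ≡ s₀) →
  ∀ {s s′} → f s ≡ true → f s′ ≡ true → s ≡ s′
only pin p q = trans (pin p) (sym (pin q))

exactlyOne⇐ : ∀ a b → a ∧ b ≡ false → ExactlyOne (slots a (not a ∧ not b) b)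
exactlyOne⇐ true  false _ = (behind , refl) , only pin
  where
  pin : ∀ {s} → slots true false false s ≡ true → s ≡ behind
  pin {behind} _ = refl
  pin {across} ()
  pin {ahead}  ()
exactlyOne⇐ false true  _ = (ahead , refl) , only pin
  where
  pin : ∀ {s} → slots false false true s ≡ true → s ≡ ahead
  pin {behind} ()
  pin {across} ()
  pin {ahead}  _ = refl
exactlyOne⇐ false false _ = (across , refl) , only pin
  where
  pin : ∀ {s} → slots false true false s ≡ true → s ≡ across
  pin {behind} ()
  pin {across} _ = refl
  pin {ahead}  ()

exactlyOne-ahead-unique : ∀ a r x y → ExactlyOne (slots a r x) → ExactlyOne (slots a r y) → x ≡ y
exactlyOne-ahead-unique a r x y one-x one-y with exactlyOne⇒ a r x one-x | exactlyOne⇒ a r y one-y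
... | a∧x , r≡ | a∧y , r≡′ = determined a x y a∧x a∧y (trans (sym r≡) r≡′)
  where
  determined : ∀ a x y → a ∧ x ≡ false → a ∧ y ≡ false → not a ∧ not x ≡ not a ∧ not y → x ≡ y
  determined true  false false _ _ _ = refl
  determined false x     y     _ _ e = not-injective e

data Side : Set where
  side-A side-B : Side

corner : ∀ {m} → Side → Fin (suc m) → Vertex m
corner side-A = A
corner side-B = B

rail : ∀ {m} → Side → Fin m → LEdge m
rail side-A = top
rail side-B = bot

rail-injective : ∀ {m} s {i j : Fin m} → rail s i ≡ rail s j → i ≡ j
rail-injective side-A refl = refl
rail-injective side-B refl = refl

rail≢rung : ∀ {m} s {j : Fin m} {v} → rail s j ≢ rung v
rail≢rung side-A ()
rail≢rung side-B ()

fsuc≢inject₁ : ∀ {m} (j : Fin m) → fsuc j ≢ inject₁ j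
fsuc≢inject₁ j eq = 1+n≢n (trans (cong toℕ eq) (toℕ-inject₁ j))

At : ∀ {m} → Side → Fin (suc m) → Slot → LEdge m → Set
At s v behind e = ∃[ j ] (e ≡ rail s j × fsuc j ≡ v)
At s v across e = e ≡ rung v
At s v ahead  e = ∃[ j ] (e ≡ rail s j × inject₁ j ≡ v)

at⇒incident : ∀ {m} s {v : Fin (suc m)} sl {e} → At s v sl e → Incident e (corner s v)
at⇒incident side-A behind (_ , refl , refl) = inj₂ refl
at⇒incident side-B behind (_ , refl , refl) = inj₂ refl
at⇒incident side-A across refl              = inj₁ refl
at⇒incident side-B across refl              = inj₂ refl
at⇒incident side-A ahead  (_ , refl , refl) = inj₁ refl
at⇒incident side-B ahead  (_ , refl , refl) = inj₁ refl

incident⇒at : ∀ {m} s {v : Fin (suc m)} e → Incident e (corner s v) → ∃[ sl ] At s v sl e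
incident⇒at side-A (rung _) (inj₁ refl) = across , refl
incident⇒at side-A (rung _) (inj₂ ())
incident⇒at side-A (top j)  (inj₁ refl) = ahead , j , refl , refl
incident⇒at side-A (top j)  (inj₂ refl) = behind , j , refl , refl
incident⇒at side-A (bot _)  (inj₁ ())
incident⇒at side-A (bot _)  (inj₂ ())
incident⇒at side-B (rung _) (inj₁ ())
incident⇒at side-B (rung _) (inj₂ refl) = across , refl
incident⇒at side-B (top _)  (inj₁ ())
incident⇒at side-B (top _)  (inj₂ ())
incident⇒at side-B (bot j)  (inj₁ refl) = ahead , j , refl , refl
incident⇒at side-B (bot j)  (inj₂ refl) = behind , j , refl , refl

at-functional : ∀ {m} s {v : Fin (suc m)} sl {e e′} → At s v sl e → At s v sl e′ → e ≡ e′
at-functional s behind (_ , refl , p) (_ , refl , p′) = cong (rail s) (Fin.suc-injective (trans p (sym p′)))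
at-functional s across p p′                           = trans p (sym p′)
at-functional s ahead  (_ , refl , p) (_ , refl , p′) = cong (rail s) (inject₁-injective (trans p (sym p′)))

at-slot-unique : ∀ {m} s {v : Fin (suc m)} sl sl′ {e} → At s v sl e → At s v sl′ e → sl ≡ sl′
at-slot-unique s behind behind _ _ = refl
at-slot-unique s across across _ _ = refl
at-slot-unique s ahead  ahead  _ _ = refl
at-slot-unique s behind across (_ , refl , _) r = ⊥-elim (rail≢rung s r)
at-slot-unique s ahead  across (_ , refl , _) r = ⊥-elim (rail≢rung s r)
at-slot-unique s across behind r (_ , refl , _) = ⊥-elim (rail≢rung s r)
at-slot-unique s across ahead  r (_ , refl , _) = ⊥-elim (rail≢rung s r)
at-slot-unique s behind ahead (j , refl , p) (j′ , eq , p′) with rail-injective s eq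
... | refl = ⊥-elim (fsuc≢inject₁ j (trans p (sym p′)))
at-slot-unique s ahead behind (j , refl , p) (j′ , eq , p′) with rail-injective s eq
... | refl = ⊥-elim (fsuc≢inject₁ j (trans p′ (sym p)))

lookupℕ-toℕ : ∀ {k} (v : Vec Bool k) i → lookupℕ v (toℕ i) ≡ lookup v i
lookupℕ-toℕ (_ ∷ _) fzero    = refl
lookupℕ-toℕ (_ ∷ v) (fsuc i) = lookupℕ-toℕ v i

lookupℕ-tabulate : ∀ {k} (f : Fin k → Bool) i → lookupℕ (tabulate f) (toℕ i) ≡ f i
lookupℕ-tabulate f i = trans (lookupℕ-toℕ (tabulate f) i) (lookup∘tabulate f i)

lookupℕ-≥ : ∀ {k} (v : Vec Bool k) x → k ≤ x → lookupℕ v x ≡ false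
lookupℕ-≥ []      _       _         = refl
lookupℕ-≥ (_ ∷ v) (suc x) (s≤s k≤x) = lookupℕ-≥ v x k≤x

lookupℕ-true⇒index : ∀ {k} (v : Vec Bool k) x → lookupℕ v x ≡ true → ∃[ i ] (toℕ i ≡ x)
lookupℕ-true⇒index v x eq = fromℕ< (lookupℕ-true⇒< v x eq) , toℕ-fromℕ< _

lookupℕ-tabulate-≗ : ∀ {k} {f : Fin k → Bool} (X : ℕ → Bool) → (∀ i → f i ≡ X (toℕ i)) →
  (∀ x → k ≤ x → X x ≡ false) → ∀ x → lookupℕ (tabulate f) x ≡ X x
lookupℕ-tabulate-≗ {zero}  X f≗X vanish x       = sym (vanish x z≤n)
lookupℕ-tabulate-≗ {suc k} X f≗X vanish zero    = f≗X fzero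
lookupℕ-tabulate-≗ {suc k} X f≗X vanish (suc x) =
  lookupℕ-tabulate-≗ (X ∘ suc) (f≗X ∘ fsuc) (λ y k≤y → vanish (suc y) (s≤s k≤y)) x

Covered : ∀ {m} → EdgeSet m → Vertex m → Set
Covered P w = ∃[ e ] (Incident e w × P e ≡ true × (∀ e′ → Incident e′ w → P e′ ≡ true → e′ ≡ e))

railSet : ∀ {m} → EdgeSet m → Side → ℕ → Bool
railSet P s = lookupℕ (tabulate (P ∘ rail s))

value : ∀ {m} → EdgeSet m → Side → Fin (suc m) → Slot → Bool
value P s v = slots (before (railSet P s) (toℕ v)) (P (rung v)) (railSet P s (toℕ v))

value-at : ∀ {m} (P : EdgeSet m) s {v} sl {e} → At s v sl e → value P s v sl ≡ P e
value-at P s behind (j , refl , refl) = lookupℕ-tabulate (P ∘ rail s) j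
value-at P s across refl              = refl
value-at P s ahead  (j , refl , refl) = trans (cong (railSet P s) (toℕ-inject₁ j)) (lookupℕ-tabulate (P ∘ rail s) j)

value-true⇒at : ∀ {m} (P : EdgeSet m) s {v} sl → value P s v sl ≡ true → ∃[ e ] At s v sl e
value-true⇒at P s {fsuc j} behind _ = rail s j , j , refl , refl
value-true⇒at P s {v}      across _ = rung v , refl
value-true⇒at P s {v}      ahead  t with lookupℕ-true⇒index (tabulate (P ∘ rail s)) (toℕ v) t
... | j , toℕj≡ = rail s j , j , refl , toℕ-injective (trans (toℕ-inject₁ j) toℕj≡)

covered⇔exactlyOne : ∀ {m} (P : EdgeSet m) s v → Covered P (corner s v) ⇔ ExactlyOne (value P s v)
covered⇔exactlyOne P s v = mk⇔ to from
  where
  to : Covered P (corner s v) → ExactlyOne (value P s v)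
  to (e , inc , Pe , unique) with incident⇒at s e inc
  ... | sl , at = (sl , trans (value-at P s sl at) Pe) , λ {sl₁} {sl₂} t₁ t₂ →
        at-slot-unique s sl₁ sl₂ (slot-of sl₁ t₁) (slot-of sl₂ t₂)
    where
    slot-of : ∀ sl′ → value P s v sl′ ≡ true → At s v sl′ e
    slot-of sl′ t with value-true⇒at P s sl′ t
    ... | e′ , at′ = subst (At s v sl′) (unique e′ (at⇒incident s sl′ at′) (trans (sym (value-at P s sl′ at′)) t)) at′
  from : ExactlyOne (value P s v) → Covered P (corner s v)
  from ((sl , t) , unique) with value-true⇒at P s sl t
  ... | e , at = e , at⇒incident s sl at , trans (sym (value-at P s sl at)) t , only-e
    where
    only-e : ∀ e′ → Incident e′ (corner s v) → P e′ ≡ true → e′ ≡ e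
    only-e e′ inc′ Pe′ with incident⇒at s e′ inc′
    ... | sl′ , at′ with unique (trans (value-at P s sl′ at′) Pe′) t
    ...   | refl = at-functional s sl′ at′ at

matching : ∀ {m} → (ℕ → Bool) → EdgeSet m
matching X (top j)  = X (toℕ j)
matching X (bot j)  = X (toℕ j)
matching X (rung v) = not (before X (toℕ v)) ∧ not (X (toℕ v))

before-cong : ∀ {X Y : ℕ → Bool} → (∀ r → X r ≡ Y r) → ∀ c → before X c ≡ before Y c
before-cong X≗Y zero    = refl
before-cong X≗Y (suc c) = X≗Y c

matching-cong : ∀ {m} {X Y : ℕ → Bool} → (∀ r → X r ≡ Y r) → ∀ (e : LEdge m) → matching X e ≡ matching Y e
matching-cong X≗Y (top j)  = X≗Y (toℕ j)
matching-cong X≗Y (bot j)  = X≗Y (toℕ j)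
matching-cong X≗Y (rung v) = cong₂ (λ a b → not a ∧ not b) (before-cong X≗Y (toℕ v)) (X≗Y (toℕ v))

module PerfectMatching {m} (P : EdgeSet m) (perfect : IsPerfectMatching P) where

  tops : ℕ → Bool
  tops = railSet P side-A

  exactlyOne-at : ∀ s c → (c≤m : c ≤ m) →
    ExactlyOne (slots (before (railSet P s) c) (P (rung (fromℕ< (s≤s c≤m)))) (railSet P s c))
  exactlyOne-at s c c≤m = subst (λ x → ExactlyOne (slots (before (railSet P s) x) (P (rung v)) (railSet P s x)))
    (toℕ-fromℕ< (s≤s c≤m)) (Equivalence.to (covered⇔exactlyOne P s v) (perfect (corner s v)))
    where
    v : Fin (suc m)
    v = fromℕ< (s≤s c≤m)

  rails-agree : ∀ c → railSet P side-A c ≡ railSet P side-B c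
  befores-agree : ∀ c → before (railSet P side-A) c ≡ before (railSet P side-B) c
  befores-agree zero    = refl
  befores-agree (suc c) = rails-agree c
  rails-agree c with c <? m
  ... | yes c<m = exactlyOne-ahead-unique _ _ _ _ (exactlyOne-at side-A c (<⇒≤ c<m))
                    (subst (λ a → ExactlyOne (slots a (P (rung (fromℕ< (s≤s (<⇒≤ c<m))))) (railSet P side-B c)))
                           (sym (befores-agree c)) (exactlyOne-at side-B c (<⇒≤ c<m)))
  ... | no  c≮m = trans (lookupℕ-≥ (tabulate (P ∘ top)) c (≮⇒≥ c≮m)) (sym (lookupℕ-≥ (tabulate (P ∘ bot)) c (≮⇒≥ c≮m)))

  sparse : Sparse tops
  sparse c with suc c ≤? m
  ... | yes c<m = proj₁ (exactlyOne⇒ _ _ _ (exactlyOne-at side-A (suc c) c<m))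
  ... | no  c≮m = trans (cong (tops c ∧_) (lookupℕ-≥ (tabulate (P ∘ top)) (suc c) (≰⇒≥ c≮m))) (∧-zeroʳ (tops c))

  is-matching : ∀ e → P e ≡ matching tops e
  is-matching (top j)  = sym (lookupℕ-tabulate (P ∘ top) j)
  is-matching (bot j)  = sym (trans (rails-agree (toℕ j)) (lookupℕ-tabulate (P ∘ bot) j))
  is-matching (rung v) = proj₂ (exactlyOne⇒ _ _ _ (Equivalence.to (covered⇔exactlyOne P side-A v) (perfect (A v))))

  top∧bot : ∀ j → P (top j) ∧ P (bot j) ≡ tops (toℕ j)
  top∧bot j = trans (cong₂ _∧_ (is-matching (top j)) (is-matching (bot j))) (∧-idem _)

railSet-matching : ∀ {m} (X : ℕ → Bool) → (∀ r → m ≤ r → X r ≡ false) → ∀ s r → railSet (matching {m} X) s r ≡ X r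
railSet-matching X vanish side-A = lookupℕ-tabulate-≗ X (λ _ → refl) vanish
railSet-matching X vanish side-B = lookupℕ-tabulate-≗ X (λ _ → refl) vanish

exactlyOne-cong : ∀ {f g : Slot → Bool} → (∀ s → f s ≡ g s) → ExactlyOne g → ExactlyOne f
exactlyOne-cong f≗g ((s , t) , unique) = (s , trans (f≗g s) t) , λ p q → unique (trans (sym (f≗g _)) p) (trans (sym (f≗g _)) q)

matching-covered : ∀ {m} (X : ℕ → Bool) → Sparse X → (∀ r → m ≤ r → X r ≡ false) →
  ∀ s v → Covered (matching {m} X) (corner s v)
matching-covered X sparse vanish s v = Equivalence.from (covered⇔exactlyOne (matching X) s v)
  (exactlyOne-cong slot-values (exactlyOne⇐ (before X (toℕ v)) (X (toℕ v)) (before-sparse (toℕ v))))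
  where
  before-sparse : ∀ c → before X c ∧ X c ≡ false
  before-sparse zero    = refl
  before-sparse (suc c) = sparse c
  slot-values : ∀ sl → value (matching X) s v sl ≡ slots (before X (toℕ v)) (not (before X (toℕ v)) ∧ not (X (toℕ v))) (X (toℕ v)) sl
  slot-values behind = before-cong (railSet-matching X vanish s) (toℕ v)
  slot-values across = refl
  slot-values ahead  = railSet-matching X vanish s (toℕ v)

matching-perfect : ∀ {m} (X : ℕ → Bool) → Sparse X → (∀ r → m ≤ r → X r ≡ false) → IsPerfectMatching (matching {m} X)
matching-perfect X sparse vanish (A v) = matching-covered X sparse vanish side-A v
matching-perfect X sparse vanish (B v) = matching-covered X sparse vanish side-B v

sparse-cong : ∀ {X Y : ℕ → Bool} → (∀ r → X r ≡ Y r) → Sparse Y → Sparse X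
sparse-cong X≗Y sparse r = trans (cong₂ _∧_ (X≗Y r) (X≗Y (suc r))) (sparse r)

toℕ-evenIx : ∀ {n} (i : Fin (suc n)) → toℕ (evenIx {n} i) ≡ toℕ i + toℕ i
toℕ-evenIx i = trans (toℕ-fromℕ< (s≤s (*-monoʳ-≤ 2 (toℕ≤pred[n] i)))) (2*n≡n+n (toℕ i))

toℕ-oddIx : ∀ {n} (j : Fin n) → toℕ (oddIx {n} j) ≡ suc (toℕ j + toℕ j)
toℕ-oddIx j = trans (toℕ-fromℕ< (s≤s (*-monoʳ-< 2 (toℕ<n j)))) (cong suc (2*n≡n+n (toℕ j)))

halves : ∀ n → EdgeSet (suc (2 * n)) → ℕ → Bool
halves n P = interleave (lookupℕ (proj₁ (φ n P))) (lookupℕ (proj₂ (φ n P)))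

even-beyond : ∀ {n k} → suc n ≤ k → suc (2 * n) ≤ k + k
even-beyond {n} {k} n<k = begin
  suc (2 * n)     ≡⟨ cong suc (2*n≡n+n n) ⟩
  suc (n + n)     ≤⟨ s≤s (+-monoʳ-≤ n (n≤1+n n)) ⟩
  suc n + suc n   ≤⟨ +-mono-≤ n<k n<k ⟩
  k + k           ∎
  where open ≤-Reasoning

odd-beyond : ∀ {n k} → n ≤ k → suc (2 * n) ≤ suc (k + k)
odd-beyond n≤k = s≤s (≤-twice n≤k)

halves-tops : ∀ n (P : EdgeSet (suc (2 * n))) (perfect : IsPerfectMatching P) →
  ∀ r → halves n P r ≡ PerfectMatching.tops P perfect r
halves-tops n P perfect r with even-or-odd r
... | inj₁ (k , refl) = trans (interleave-even (lookupℕ (proj₁ (φ n P))) (lookupℕ (proj₂ (φ n P))) k)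
      (lookupℕ-tabulate-≗ (λ k → tops (k + k)) (λ i → trans (top∧bot (evenIx {n} i)) (cong tops (toℕ-evenIx {n} i)))
        (λ k n<k → lookupℕ-≥ (tabulate (P ∘ top)) (k + k) (even-beyond n<k)) k)
  where open PerfectMatching P perfect
... | inj₂ (k , refl) = trans (interleave-odd (lookupℕ (proj₁ (φ n P))) (lookupℕ (proj₂ (φ n P))) k)
      (lookupℕ-tabulate-≗ (λ k → tops (suc (k + k))) (λ i → trans (top∧bot (oddIx {n} i)) (cong tops (toℕ-oddIx {n} i)))
        (λ k n≤k → lookupℕ-≥ (tabulate (P ∘ top)) (suc (k + k)) (odd-beyond n≤k)) k)
  where open PerfectMatching P perfect

interleave-vanishes : ∀ n (S₁ : Subset (suc n)) (S₂ : Subset n) r → suc (2 * n) ≤ r →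
  interleave (lookupℕ S₁) (lookupℕ S₂) r ≡ false
interleave-vanishes n S₁ S₂ r beyond with even-or-odd r
... | inj₁ (k , refl) = trans (interleave-even (lookupℕ S₁) (lookupℕ S₂) k)
                              (lookupℕ-≥ S₁ k (≰⇒> (λ k≤n → <-irrefl refl (<-≤-trans (s≤s (twice-≤ k≤n)) beyond))))
... | inj₂ (k , refl) = trans (interleave-odd (lookupℕ S₁) (lookupℕ S₂) k)
                              (lookupℕ-≥ S₂ k (≮⇒≥ (λ k<n → <-irrefl refl (<-≤-trans (twice-< k<n) (s≤s⁻¹ beyond)))))

φ-matching : ∀ n (S₁ : Subset (suc n)) (S₂ : Subset n) → φ n (matching (interleave (lookupℕ S₁) (lookupℕ S₂))) ≡ (S₁ , S₂)
φ-matching n S₁ S₂ = cong₂ _,_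
  (trans (tabulate-cong (λ i → trans (∧-idem _) (trans (cong X (toℕ-evenIx {n} i))
           (trans (interleave-even (lookupℕ S₁) (lookupℕ S₂) (toℕ i)) (lookupℕ-toℕ S₁ i)))))
         (tabulate∘lookup S₁))
  (trans (tabulate-cong (λ i → trans (∧-idem _) (trans (cong X (toℕ-oddIx {n} i))
           (trans (interleave-odd (lookupℕ S₁) (lookupℕ S₂) (toℕ i)) (lookupℕ-toℕ S₂ i)))))
         (tabulate∘lookup S₂))
  where
  X : ℕ → Bool
  X = interleave (lookupℕ S₁) (lookupℕ S₂)

φ-compatible : ∀ n (P : EdgeSet (suc (2 * n))) → IsPerfectMatching P → Compatible n (φ n P)
φ-compatible n P perfect = DyckPair.sparse⇒compatible n _ _ (sparse-cong (halves-tops n P perfect) (PerfectMatching.sparse P perfect))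

φ-injective : ∀ n (P Q : EdgeSet (suc (2 * n))) → IsPerfectMatching P → IsPerfectMatching Q →
  φ n P ≡ φ n Q → ∀ e → P e ≡ Q e
φ-injective n P Q perfect-P perfect-Q φP≡φQ e = begin
  P e                  ≡⟨ PerfectMatching.is-matching P perfect-P e ⟩
  matching tops-P e    ≡⟨ matching-cong same-tops e ⟩
  matching tops-Q e    ≡⟨ PerfectMatching.is-matching Q perfect-Q e ⟨
  Q e                  ∎
  where
  open ≡-Reasoning
  tops-P tops-Q : ℕ → Bool
  tops-P = PerfectMatching.tops P perfect-P
  tops-Q = PerfectMatching.tops Q perfect-Q
  same-tops : ∀ r → tops-P r ≡ tops-Q r
  same-tops r = trans (sym (halves-tops n P perfect-P r))
                      (trans (cong (λ S → interleave (lookupℕ (proj₁ S)) (lookupℕ (proj₂ S)) r) φP≡φQ)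
                             (halves-tops n Q perfect-Q r))

φ-surjective : ∀ n S → Compatible n S → ∃[ P ] (IsPerfectMatching P × φ n P ≡ S)
φ-surjective n (S₁ , S₂) compatible =
  matching X , matching-perfect X (DyckPair.compatible⇒sparse n S₁ S₂ compatible) (interleave-vanishes n S₁ S₂) , φ-matching n S₁ S₂
  where
  X : ℕ → Bool
  X = interleave (lookupℕ S₁) (lookupℕ S₂)

mainTheorem2 : ∀ (n : ℕ) →
    (∀ (P : EdgeSet (suc (2 * n))) → IsPerfectMatching P → Compatible n (φ n P))
  × (∀ (P Q : EdgeSet (suc (2 * n))) → IsPerfectMatching P → IsPerfectMatching Q →
       φ n P ≡ φ n Q → ∀ e → P e ≡ Q e)
  × (∀ S → Compatible n S → ∃[ P ] (IsPerfectMatching P × φ n P ≡ S))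
mainTheorem2 n = φ-compatible n , φ-injective n , φ-surjective n
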